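{- For all integers $n \geq 1$ and $1 \leq i \leq n$, the number $\tau(n, n-i)$ of $\tau$-sequences of length $n$ with first term $a_1 = n-i$ equals $\frac{1}{2}(i^2 - i + 2)$.
   Context: A $\tau$-sequence of length $n$ is a sequence of integers $a_1 a_2 \dots a_n$ such that, with indices taken cyclically modulo $n$ (so $a_0 = a_n$): (i) $a_i \geq 0$ for all $i$; (ii) if $a_i > 0$ then $a_{i-1} = a_i - 1$; (iii) there are at most three indices $i$ with $a_i = 0$. (Equivalently, every cyclic rotation of the sequence satisfies (i)–(iii) with ordinary indices, condition (ii) being required for $i \geq 2$; informally, a $\tau$-sequence is a cyclic rotation of a concatenation of one, two or three runs $0,1,2,\dots$.) $\tau(n,\alpha)$ denotes the number of $\tau$-sequences of length $n$ with $a_1 = \alpha$. -}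

module Defs where

open import Data.Nat using (ℕ; zero; suc; _+_; _∸_; _≤_; _<_)
open import Data.Fin using (Fin; fromℕ; inject₁)
open import Data.Vec using (Vec; lookup; head; count)
open import Data.Product using (_×_)
open import Data.List using (List; length)
open import Data.List.Relation.Unary.All using (All)
open import Data.List.Relation.Unary.Unique.Propositional using (Unique)
open import Data.List.Membership.Propositional using (_∈_)
open import Relation.Binary.PropositionalEquality using (_≡_)
open import Data.Nat using (_≟_)
open import Data.Empty using (⊥)

prevIdx : ∀ {m} → Fin (suc m) → Fin (suc m)
prevIdx {m} Fin.zero = fromℕ m
prevIdx (Fin.suc i) = inject₁ i

-- Positions 0..m of a vector of length n = suc m stand for a_1..a_n.
-- (i) a_i ≥ 0 is automatic (entries are natural numbers);
-- (ii) a_i > 0 ⇒ a_{i-1} = a_i - 1, indices cyclic;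
-- (iii) at most three indices i with a_i = 0.
IsTauSeq : ∀ {m} → Vec ℕ (suc m) → Set
IsTauSeq {m} a =
  (∀ (i : Fin (suc m)) → 0 < lookup a i → lookup a (prevIdx i) ≡ lookup a i ∸ 1)
  × count (_≟ 0) a ≤ 3

-- τ(n, α) = k, for n = suc m: the τ-sequences of length n with a_1 = α are exactly
-- the elements of some duplicate-free list of length k.
TauCount : ℕ → ℕ → ℕ → Set
TauCount (suc m) α k =
  Data.Product.Σ (List (Vec ℕ (suc m))) λ xs →
    Unique xs × length xs ≡ k
    × All (λ a → IsTauSeq a × head a ≡ α) xs
    × (∀ (a : Vec ℕ (suc m)) → IsTauSeq a → head a ≡ α → a ∈ xs)
-- length 0 does not occur (n ≥ 1 in the paper)
TauCount zero α k = ⊥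

module Submission where

-- A τ-sequence a₁ a₂ … aₙ is read from left to right: every entry after a₁ is
-- either 0 (a new run starts) or one more than its predecessor, which makes
-- a₂ … aₙ a "chain after a₁"; the cyclic condition at a₁ then only asks that
-- aₙ = a₁ - 1 when a₁ > 0, and at most three entries may vanish.
--
-- Counting chains amounts to choosing the positions of
-- the zeros, so the counts are the partial binomial sums binomSum z m =
-- Σ_{j<z} (m choose j): without a test (a₁ = 0, two more zeros allowed) this is
-- immediate, and for the test "last value = e" the final e + 1 entries are
-- forced to be 0,1,…,e, leaving binomSum z m choices.  Hence
-- τ(α + k + 1, α) = binomSum 3 k = (k² + k + 2)/2 for every α, which is the
-- theorem with i = k + 1 and α = n - i.

open import Defs
open import Data.Nat
  using (ℕ; zero; suc; _+_; _*_; _∸_; _/_; _≤_; _<_; _≡ᵇ_; _≟_; z≤n; s≤s; s≤s⁻¹)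
open import Data.Nat.Properties
  using (+-suc; +-comm; +-identityʳ; ≤-refl; <⇒≤; *-distribʳ-+; <⇒≢; m≤n+m; m+n∸m≡n; m∸n+n≡m; ≡ᵇ⇒≡; ≡⇒≡ᵇ)
open import Data.Nat.DivMod using (m*n/n≡m)
open import Data.Nat.Tactic.RingSolver using (solve-∀)
open import Data.Bool using (Bool; true; false; T)
open import Data.Unit using (⊤; tt)
open import Data.Empty using (⊥-elim)
open import Data.Fin using (Fin; fromℕ; inject₁)
open import Data.Vec using (Vec; []; _∷_; lookup; count)
open import Data.Vec.Properties using (∷-injectiveʳ)
open import Data.List using (List; []; _∷_; [_]; map; _++_; length)
open import Data.List.Properties using (length-++; length-map)
import Data.List.Relation.Unary.All as All
open import Data.List.Relation.Unary.All using (All; []; _∷_)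
import Data.List.Relation.Unary.All.Properties as AllP
open import Data.List.Relation.Unary.Unique.Propositional using (Unique)
import Data.List.Relation.Unary.Unique.Propositional.Properties as UniqueP
import Data.List.Relation.Unary.AllPairs as AllPairs
open import Data.List.Membership.Propositional using (_∈_)
open import Data.List.Membership.Propositional.Properties using (∈-map⁺; ∈-map⁻; ∈-++⁺ˡ; ∈-++⁺ʳ)
open import Data.List.Relation.Unary.Any using (here)
open import Data.Product using (_×_; _,_)
open import Relation.Nullary using (¬_)
open import Relation.Binary.PropositionalEquality
  using (_≡_; _≢_; refl; sym; trans; cong; cong₂; subst; subst₂; module ≡-Reasoning)

Chain : ∀ {m} → ℕ → Vec ℕ m → Set
Chain q [] = ⊤
Chain q (y ∷ w) = (0 < y → q ≡ y ∸ 1) × Chain y w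

lastAfter : ∀ {m} → ℕ → Vec ℕ m → ℕ
lastAfter q [] = q
lastAfter q (y ∷ w) = lastAfter y w

zeros : ∀ {m} → Vec ℕ m → ℕ
zeros = count (_≟ 0)

lookup-last : ∀ {m} (q : ℕ) (v : Vec ℕ m) → lookup (q ∷ v) (fromℕ m) ≡ lastAfter q v
lookup-last q [] = refl
lookup-last q (y ∷ w) = lookup-last y w

chain⇒lookup : ∀ {m q} {v : Vec ℕ m} → Chain q v →
  ∀ j → 0 < lookup v j → lookup (q ∷ v) (inject₁ j) ≡ lookup v j ∸ 1
chain⇒lookup {v = y ∷ w} (step , _) Fin.zero = step
chain⇒lookup {v = y ∷ w} (_ , chain) (Fin.suc j) = chain⇒lookup chain j

lookup⇒chain : ∀ {m q} {v : Vec ℕ m} →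
  (∀ j → 0 < lookup v j → lookup (q ∷ v) (inject₁ j) ≡ lookup v j ∸ 1) → Chain q v
lookup⇒chain {v = []} _ = tt
lookup⇒chain {v = y ∷ w} steps = steps Fin.zero , lookup⇒chain (λ j → steps (Fin.suc j))

tau-cons⁻ : ∀ {m α} {v : Vec ℕ m} → IsTauSeq (α ∷ v) →
  Chain α v × (0 < α → lastAfter α v ≡ α ∸ 1) × zeros (α ∷ v) ≤ 3
tau-cons⁻ {α = α} {v} (steps , bound) =
  lookup⇒chain (λ j → steps (Fin.suc j)) ,
  (λ pos → trans (sym (lookup-last α v)) (steps Fin.zero pos)) ,
  bound

tau-cons⁺ : ∀ {m α} {v : Vec ℕ m} →
  Chain α v × (0 < α → lastAfter α v ≡ α ∸ 1) × zeros (α ∷ v) ≤ 3 → IsTauSeq (α ∷ v)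
tau-cons⁺ {α = α} {v} (chain , close , bound) = steps , bound
  where
  steps : ∀ i → 0 < lookup (α ∷ v) i → lookup (α ∷ v) (prevIdx i) ≡ lookup (α ∷ v) i ∸ 1
  steps Fin.zero pos = trans (lookup-last α v) (close pos)
  steps (Fin.suc j) = chain⇒lookup chain j

Admissible : ∀ {m} → (ℕ → Bool) → ℕ → ℕ → Vec ℕ m → Set
Admissible t q z v = Chain q v × zeros v ≤ z × T (t (lastAfter q v))

ifPasses : Bool → List (Vec ℕ 0)
ifPasses true = [ [] ]
ifPasses false = []

ifPasses-sound : ∀ {P : Vec ℕ 0 → Set} b → (T b → P []) → All P (ifPasses b)
ifPasses-sound true p = p tt ∷ []
ifPasses-sound false _ = []

ifPasses-complete : ∀ b → T b → [] ∈ ifPasses b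
ifPasses-complete true _ = here refl

ifPasses-unique : ∀ b → Unique (ifPasses b)
ifPasses-unique true = [] AllPairs.∷ AllPairs.[]
ifPasses-unique false = AllPairs.[]

chains : (ℕ → Bool) → (m : ℕ) → ℕ → ℕ → List (Vec ℕ m)
chains t zero q z = ifPasses (t q)
chains t (suc m) q zero = map (suc q ∷_) (chains t m (suc q) zero)
chains t (suc m) q (suc z) =
  map (0 ∷_) (chains t m 0 z) ++ map (suc q ∷_) (chains t m (suc q) (suc z))

chains-sound : ∀ t m q z → All (Admissible t q z) (chains t m q z)
chains-sound t zero q z = ifPasses-sound (t q) (λ pass → tt , z≤n , pass)
chains-sound t (suc m) q zero =
  AllP.map⁺ (All.map (λ { (chain , bound , pass) → ((λ _ → refl) , chain) , bound , pass })
    (chains-sound t m (suc q) zero))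
chains-sound t (suc m) q (suc z) = AllP.++⁺
  (AllP.map⁺ (All.map (λ { (chain , bound , pass) → ((λ ()) , chain) , s≤s bound , pass })
    (chains-sound t m 0 z)))
  (AllP.map⁺ (All.map (λ { (chain , bound , pass) → ((λ _ → refl) , chain) , bound , pass })
    (chains-sound t m (suc q) (suc z))))

chains-complete : ∀ t m q z (v : Vec ℕ m) → Admissible t q z v → v ∈ chains t m q z
chains-complete t zero q z [] (_ , _ , pass) = ifPasses-complete (t q) pass
chains-complete t (suc m) q zero (zero ∷ w) (_ , () , _)
chains-complete t (suc m) q (suc z) (zero ∷ w) ((_ , chain) , s≤s bound , pass) =
  ∈-++⁺ˡ (∈-map⁺ (0 ∷_) (chains-complete t m 0 z w (chain , bound , pass)))
chains-complete t (suc m) q zero (suc y ∷ w) ((step , chain) , bound , pass)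
  with refl ← step (s≤s z≤n) =
  ∈-map⁺ (suc q ∷_) (chains-complete t m (suc q) zero w (chain , bound , pass))
chains-complete t (suc m) q (suc z) (suc y ∷ w) ((step , chain) , bound , pass)
  with refl ← step (s≤s z≤n) =
  ∈-++⁺ʳ _ (∈-map⁺ (suc q ∷_) (chains-complete t m (suc q) (suc z) w (chain , bound , pass)))

chains-unique : ∀ t m q z → Unique (chains t m q z)
chains-unique t zero q z = ifPasses-unique (t q)
chains-unique t (suc m) q zero = UniqueP.map⁺ ∷-injectiveʳ (chains-unique t m (suc q) zero)
chains-unique t (suc m) q (suc z) =
  UniqueP.++⁺ (UniqueP.map⁺ ∷-injectiveʳ (chains-unique t m 0 z))
    (UniqueP.map⁺ ∷-injectiveʳ (chains-unique t m (suc q) (suc z))) disjoint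
  where
  -- the two halves differ in their first entry
  disjoint : ∀ {v} → ¬ (v ∈ map (0 ∷_) (chains t m 0 z) × v ∈ map (suc q ∷_) (chains t m (suc q) (suc z)))
  disjoint (v∈zeros , v∈succs) with ∈-map⁻ (0 ∷_) v∈zeros | ∈-map⁻ (suc q ∷_) v∈succs
  ... | _ , _ , refl | _ , _ , ()

indicator : Bool → ℕ
indicator true = 1
indicator false = 0

#chains : (ℕ → Bool) → ℕ → ℕ → ℕ → ℕ
#chains t zero q z = indicator (t q)
#chains t (suc m) q zero = #chains t m (suc q) zero
#chains t (suc m) q (suc z) = #chains t m 0 z + #chains t m (suc q) (suc z)

length-chains : ∀ t m q z → length (chains t m q z) ≡ #chains t m q z
length-chains t zero q z with t q
... | true = refl
... | false = refl
length-chains t (suc m) q zero =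
  trans (length-map (suc q ∷_) (chains t m (suc q) zero)) (length-chains t m (suc q) zero)
length-chains t (suc m) q (suc z) = begin
  length (map (0 ∷_) zeroFirst ++ map (suc q ∷_) succFirst)
    ≡⟨ length-++ (map (0 ∷_) zeroFirst) ⟩
  length (map (0 ∷_) zeroFirst) + length (map (suc q ∷_) succFirst)
    ≡⟨ cong₂ _+_ (length-map (0 ∷_) zeroFirst) (length-map (suc q ∷_) succFirst) ⟩
  length zeroFirst + length succFirst
    ≡⟨ cong₂ _+_ (length-chains t m 0 z) (length-chains t m (suc q) (suc z)) ⟩
  #chains t m 0 z + #chains t m (suc q) (suc z) ∎
  where
  open ≡-Reasoning
  zeroFirst = chains t m 0 z
  succFirst = chains t m (suc q) (suc z)

-- binomSum z m = Σ_{j<z} (m choose j), the number of ways to mark fewer than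
-- z of m positions (Pascal's rule on whether the first position is marked).
binomSum : ℕ → ℕ → ℕ
binomSum zero m = 0
binomSum (suc z) zero = 1
binomSum (suc z) (suc m) = binomSum z m + binomSum (suc z) m

-- Without a test, a chain is determined by the set of positions of its zeros.
#chains-free : ∀ m q z → #chains (λ _ → true) m q z ≡ binomSum (suc z) m
#chains-free zero q z = refl
#chains-free (suc m) q zero = #chains-free m (suc q) zero
#chains-free (suc m) q (suc z) = cong₂ _+_ (#chains-free m 0 z) (#chains-free m (suc q) (suc z))

δ : ℕ → ℕ → ℕ
δ x e = indicator (x ≡ᵇ e)

δ-refl : ∀ e → δ e e ≡ 1
δ-refl zero = refl
δ-refl (suc e) = δ-refl e

δ-≢ : ∀ {x e} → x ≢ e → δ x e ≡ 0
δ-≢ {x} {e} x≢e with x ≡ᵇ e in eq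
... | false = refl
... | true = ⊥-elim (x≢e (≡ᵇ⇒≡ x e (subst T (sym eq) tt)))

-- Without a zero, a chain after q + 1 of length e ends above e.
δ-overshoot : ∀ q e → δ (suc q + e) e ≡ 0
δ-overshoot q e = δ-≢ (λ eq → <⇒≢ (s≤s (m≤n+m e q)) (sym eq))

endsAt : ℕ → ℕ → Bool
endsAt e x = x ≡ᵇ e

-- A chain after p of length m ≤ e can only end at e if it has no zero, i.e.
-- if p + m = e: after a zero fewer than e steps remain to climb back.
#chains-short : ∀ e m p z → m ≤ e → #chains (endsAt e) m p z ≡ δ (p + m) e
#chains-short e zero p z _ = cong (λ x → δ x e) (sym (+-identityʳ p))
#chains-short e (suc m) p zero m<e =
  trans (#chains-short e m (suc p) zero (<⇒≤ m<e)) (cong (λ x → δ x e) (sym (+-suc p m)))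
#chains-short e (suc m) p (suc z) m<e = begin
  #chains (endsAt e) m 0 z + #chains (endsAt e) m (suc p) (suc z)
    ≡⟨ cong₂ _+_ (#chains-short e m 0 z (<⇒≤ m<e)) (#chains-short e m (suc p) (suc z) (<⇒≤ m<e)) ⟩
  δ m e + δ (suc p + m) e
    ≡⟨ cong₂ _+_ (δ-≢ (<⇒≢ m<e)) (cong (λ x → δ x e) (sym (+-suc p m))) ⟩
  δ (p + suc m) e ∎
  where open ≡-Reasoning

-- A chain ending at e with m + e + 1 entries ends with the run 0,1,…,e; the
-- zeros among its first m entries may be placed freely.
#chains-endsAt : ∀ e m q z → #chains (endsAt e) (m + suc e) q z ≡ binomSum z m
#chains-endsAt e zero q zero =
  trans (#chains-short e e (suc q) zero ≤-refl) (δ-overshoot q e)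
#chains-endsAt e zero q (suc z) =
  cong₂ _+_ (trans (#chains-short e e 0 z ≤-refl) (δ-refl e))
            (trans (#chains-short e e (suc q) (suc z) ≤-refl) (δ-overshoot q e))
#chains-endsAt e (suc m) q zero = #chains-endsAt e m (suc q) zero
#chains-endsAt e (suc m) q (suc z) =
  cong₂ _+_ (#chains-endsAt e m 0 z) (#chains-endsAt e m (suc q) (suc z))

tauCount-by-chains : ∀ {m} α t z →
  (∀ (v : Vec ℕ m) → IsTauSeq (α ∷ v) → Admissible t α z v) →
  (∀ (v : Vec ℕ m) → Admissible t α z v → IsTauSeq (α ∷ v)) →
  TauCount (suc m) α (#chains t m α z)
tauCount-by-chains {m} α t z tail-admissible admissible-tau =
  map (α ∷_) (chains t m α z) ,
  UniqueP.map⁺ ∷-injectiveʳ (chains-unique t m α z) ,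
  trans (length-map (α ∷_) (chains t m α z)) (length-chains t m α z) ,
  AllP.map⁺ (All.map (λ {v} adm → admissible-tau v adm , refl) (chains-sound t m α z)) ,
  λ { (_ ∷ v) τ refl → ∈-map⁺ (α ∷_) (chains-complete t m α z v (tail-admissible v τ)) }

-- α = 0: the cyclic condition at a₁ is void and two more zeros are allowed.
tauCount-zero : ∀ k → TauCount (suc k) 0 (binomSum 3 k)
tauCount-zero k =
  subst (TauCount (suc k) 0) (#chains-free k 0 2)
    (tauCount-by-chains 0 (λ _ → true) 2
      (λ v τ → let (chain , _ , bound) = tau-cons⁻ τ in chain , s≤s⁻¹ bound , tt)
      (λ v (chain , bound , _) → tau-cons⁺ (chain , (λ ()) , s≤s bound)))

-- α = β + 1: a₁ is not a zero, and the last entry must be β.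
tauCount-suc : ∀ k β → TauCount (suc (suc β + k)) (suc β) (binomSum 3 k)
tauCount-suc k β =
  subst (TauCount (suc (suc β + k)) (suc β)) tail-count
    (tauCount-by-chains (suc β) (endsAt β) 3
      (λ v τ → let (chain , close , bound) = tau-cons⁻ τ in
        chain , bound , ≡⇒≡ᵇ _ β (close (s≤s z≤n)))
      (λ v (chain , bound , ends) → tau-cons⁺ (chain , (λ _ → ≡ᵇ⇒≡ _ β ends) , bound)))
  where
  tail-count : #chains (endsAt β) (suc β + k) (suc β) 3 ≡ binomSum 3 k
  tail-count = trans
    (cong (λ m → #chains (endsAt β) m (suc β) 3) (+-comm (suc β) k))
    (#chains-endsAt β k (suc β) 3)

tauCount-head : ∀ k α → TauCount (suc (α + k)) α (binomSum 3 k)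
tauCount-head k zero = tauCount-zero k
tauCount-head k (suc β) = tauCount-suc k β

-- binomSum 3 k = 1 + k + k(k-1)/2 = (k(k + 1) + 2)/2.
binomSum-3 : ∀ k → binomSum 3 k * 2 ≡ k * suc k + 2
binomSum-3 zero = refl
binomSum-3 (suc k) = begin
  (binomSum 2 k + binomSum 3 k) * 2  ≡⟨ *-distribʳ-+ 2 (binomSum 2 k) (binomSum 3 k) ⟩
  binomSum 2 k * 2 + binomSum 3 k * 2 ≡⟨ cong₂ (λ a b → a * 2 + b) (binomSum-2 k) (binomSum-3 k) ⟩
  suc k * 2 + (k * suc k + 2)         ≡⟨ expand k ⟩
  suc k * suc (suc k) + 2            ∎
  where
  open ≡-Reasoning
  binomSum-1 : ∀ k → binomSum 1 k ≡ 1
  binomSum-1 zero = refl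
  binomSum-1 (suc k) = binomSum-1 k
  binomSum-2 : ∀ k → binomSum 2 k ≡ suc k
  binomSum-2 zero = refl
  binomSum-2 (suc k) = cong₂ _+_ (binomSum-1 k) (binomSum-2 k)
  expand : ∀ k → suc k * 2 + (k * suc k + 2) ≡ suc k * suc (suc k) + 2
  expand = solve-∀

count-formula : ∀ k → (suc k * suc k ∸ suc k + 2) / 2 ≡ binomSum 3 k
count-formula k = begin
  (suc k * suc k ∸ suc k + 2) / 2  ≡⟨ cong (λ x → (x + 2) / 2) (m+n∸m≡n (suc k) (k * suc k)) ⟩
  (k * suc k + 2) / 2              ≡⟨ cong (_/ 2) (sym (binomSum-3 k)) ⟩
  binomSum 3 k * 2 / 2             ≡⟨ m*n/n≡m (binomSum 3 k) 2 ⟩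
  binomSum 3 k                     ∎
  where open ≡-Reasoning

mainTheorem16 : ∀ (n i : ℕ) → 1 ≤ n → 1 ≤ i → i ≤ n →
    TauCount n (n ∸ i) ((i * i ∸ i + 2) / 2)
mainTheorem16 (suc m) (suc k) _ _ (s≤s k≤m) =
  subst₂ (λ n c → TauCount (suc n) (m ∸ k) c)
    (m∸n+n≡m k≤m) (sym (count-formula k)) (tauCount-head k (m ∸ k))
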